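{- Let $n,m\ge 1$. There are exactly $2^{nm}$ Pascal-like matrices in $\mathbb{Z}^{n\times m}$. Any two of them are congruent entrywise modulo $2$. Moreover, for each $q\in\{3,4,6\}$, every Pascal-like matrix in $(\mathbb{Z}/q\mathbb{Z})^{n\times m}$ is the entrywise reduction modulo $q$ of some Pascal-like matrix in $\mathbb{Z}^{n\times m}$.
   Context: For a commutative ring $R$, index the rows of $M\in R^{n\times m}$ by $0,\dots,n-1$ and columns by $0,\dots,m-1$. A square sub-matrix lying on the upper border is one of the form $M_{[0:k),[j:j+k)}$ (rows $0,\dots,k-1$, columns $j,\dots,j+k-1$), and one lying on the left border is of the form $M_{[i:i+k),[0:k)}$ (rows $i,\dots,i+k-1$, columns $0,\dots,k-1$), with $k\ge 1$ and the index ranges contained in those of $M$. The matrix $M$ is called Pascal-like if every square sub-matrix lying on the upper border or on the left border has determinant a unit of $R$ (over $\mathbb{Z}$: determinant $\pm 1$). -}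

module Defs where

open import Level using (0ℓ)
open import Algebra.Bundles.Raw using (RawRing)
open import Data.Nat as ℕ using (ℕ; zero; suc; _≤_; _<_)
open import Data.Nat.Properties using (≤-trans; <-≤-trans; +-monoʳ-<)
open import Data.Fin using (Fin; toℕ; fromℕ<; punchIn)
open import Data.Fin.Properties using (toℕ<n)
open import Data.Integer as ℤ using (ℤ; +_)
open import Data.Integer.Divisibility using (_∣_)
open import Data.Product using (Σ; _×_)
open import Relation.Binary.PropositionalEquality using (_≡_)

Matrix : Set → ℕ → ℕ → Set
Matrix A n m = Fin n → Fin m → A

_≗ᴹ_ : ∀ {n m} → Matrix ℤ n m → Matrix ℤ n m → Set
M ≗ᴹ N = ∀ i j → M i j ≡ N i j

module _ (R : RawRing 0ℓ 0ℓ) where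
  open RawRing R

  altSum : ∀ {k} → (Fin k → Carrier) → Carrier
  altSum {zero}  f = 0#
  altSum {suc k} f = f Fin.zero + - altSum (λ j → f (Fin.suc j))

  det : ∀ {k} → Matrix Carrier k k → Carrier
  det {zero}  M = 1#
  det {suc k} M =
    altSum (λ j → M Fin.zero j * det (λ a b → M (Fin.suc a) (punchIn j b)))

  IsUnit : Carrier → Set
  IsUnit x = Σ Carrier (λ y → (x * y) ≈ 1#)

  -- Square sub-matrix on the upper border: rows [0,k), columns [j,j+k).
  upperSub : ∀ {n m} → Matrix Carrier n m → (k j : ℕ) → k ≤ n → j ℕ.+ k ≤ m
           → Matrix Carrier k k
  upperSub M k j k≤n jk≤m a b =
    M (fromℕ< (<-≤-trans (toℕ<n a) k≤n))
      (fromℕ< (<-≤-trans (+-monoʳ-< j (toℕ<n b)) jk≤m))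

  -- Square sub-matrix on the left border: rows [i,i+k), columns [0,k).
  leftSub : ∀ {n m} → Matrix Carrier n m → (k i : ℕ) → i ℕ.+ k ≤ n → k ≤ m
          → Matrix Carrier k k
  leftSub M k i ik≤n k≤m a b =
    M (fromℕ< (<-≤-trans (+-monoʳ-< i (toℕ<n a)) ik≤n))
      (fromℕ< (<-≤-trans (toℕ<n b) k≤m))

  PascalLike : ∀ {n m} → Matrix Carrier n m → Set
  PascalLike {n} {m} M =
    (∀ (k j : ℕ) → 1 ≤ k → (k≤n : k ≤ n) → (jk≤m : j ℕ.+ k ≤ m)
       → IsUnit (det (upperSub M k j k≤n jk≤m)))
    × (∀ (k i : ℕ) → 1 ≤ k → (ik≤n : i ℕ.+ k ≤ n) → (k≤m : k ≤ m)
       → IsUnit (det (leftSub M k i ik≤n k≤m)))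

ℤ-rawRing : RawRing 0ℓ 0ℓ
ℤ-rawRing = record
  { Carrier = ℤ ; _≈_ = _≡_ ; _+_ = ℤ._+_ ; _*_ = ℤ._*_ ; -_ = ℤ.-_
  ; 0# = + 0 ; 1# = + 1 }

_≡_[mod_] : ℤ → ℤ → ℕ → Set
a ≡ b [mod q ] = (+ q) ∣ (a ℤ.- b)

-- The ring ℤ/qℤ, presented as ℤ with equality = congruence mod q
-- (a setoid quotient; elements are represented by integers).
ℤmod : ℕ → RawRing 0ℓ 0ℓ
ℤmod q = record
  { Carrier = ℤ ; _≈_ = λ a b → a ≡ b [mod q ] ; _+_ = ℤ._+_ ; _*_ = ℤ._*_
  ; -_ = ℤ.-_ ; 0# = + 0 ; 1# = + 1 }

-- For a matrix F and a cell (r, c), let the border determinant be the determinant of the largest square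
-- with bottom-right corner (r, c); this square lies on the upper or on the left border. Expanding it in
-- its corner entry gives
--   borderDet (r, c) = (a polynomial in entries on earlier antidiagonals) + F r c · borderDet (r-1, c-1),
-- where borderDet (r-1, c-1) is read as 1 on the border. Going along antidiagonals, the entries are
-- therefore determined modulo q by the border determinants as long as these are units modulo q, and
-- every choice of border determinants ±1 is realised by an integer matrix. So the Pascal-like integer
-- matrices correspond to the 2^(nm) sign patterns; as ±1 ≡ 1 (mod 2), any two of them agree modulo 2;
-- and as every unit modulo 3, 4 or 6 is ±1, a Pascal-like matrix modulo such q is the reduction of the
-- integer matrix with the corresponding signs.
module Submission where

open import Defs

module BorderDeterminants where

  open import Level using (0ℓ)
  open import Data.Bool using (Bool; true; false; _∧_; if_then_else_)
  open import Data.Bool.Properties using (∧-zeroʳ)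
  open import Data.Empty using (⊥-elim)
  open import Data.Fin as Fin
    using (Fin; toℕ; fromℕ; fromℕ<; inject₁; punchIn; combine; remQuot; finToFun; funToFin)
  import Data.Fin.Properties as FinP
  open import Data.Integer as ℤ using (ℤ; +_; -[1+_]; _+_; _*_; -_; _-_; ∣_∣)
  import Data.Integer.DivMod as ℤDivMod
  import Data.Integer.Divisibility.Signed as ℤDiv
  import Data.Integer.Properties as ℤP
  open import Data.Integer.Tactic.RingSolver using (solve-∀)
  open import Data.Nat as ℕ using (ℕ; zero; suc; _≤_; _<_; _⊓_; _∸_)
  import Data.Nat.Divisibility as ℕDiv
  open import Data.Nat.Induction using (<-rec)
  import Data.Nat.Properties as ℕP
  open import Data.Product using (Σ; _×_; _,_; proj₁; proj₂)
  open import Data.Sum using (_⊎_; inj₁; inj₂)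
  open import Function using (_∘_)
  open import Relation.Binary.Bundles using (Setoid)
  import Relation.Binary.Reasoning.Setoid as SetoidReasoning
  open import Relation.Binary.PropositionalEquality
  open import Relation.Nullary using (Dec; yes; no)
  open import Relation.Nullary.Decidable using (map′; from-yes; _→-dec_; _⊎-dec_)

  -- Determinants over ℤ

  detℤ : ∀ {k} → Matrix ℤ k k → ℤ
  detℤ = det ℤ-rawRing

  altSumℤ : ∀ {k} → (Fin k → ℤ) → ℤ
  altSumℤ = altSum ℤ-rawRing

  altSum-cong : ∀ {k} {f g : Fin k → ℤ} → (∀ j → f j ≡ g j) → altSumℤ f ≡ altSumℤ g
  altSum-cong {zero}  f≗g = refl
  altSum-cong {suc k} f≗g = cong₂ (λ x s → x + - s) (f≗g Fin.zero) (altSum-cong (f≗g ∘ Fin.suc))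

  altSum-+ : ∀ {k} (f g : Fin k → ℤ) → altSumℤ (λ j → f j + g j) ≡ altSumℤ f + altSumℤ g
  altSum-+ {zero}  f g = refl
  altSum-+ {suc k} f g = begin
    f Fin.zero + g Fin.zero + - altSumℤ (λ j → f (Fin.suc j) + g (Fin.suc j))
      ≡⟨ cong (λ s → f Fin.zero + g Fin.zero + - s) (altSum-+ (f ∘ Fin.suc) (g ∘ Fin.suc)) ⟩
    f Fin.zero + g Fin.zero + - (altSumℤ (f ∘ Fin.suc) + altSumℤ (g ∘ Fin.suc))
      ≡⟨ interchange (f Fin.zero) (g Fin.zero) (altSumℤ (f ∘ Fin.suc)) (altSumℤ (g ∘ Fin.suc)) ⟩
    (f Fin.zero + - altSumℤ (f ∘ Fin.suc)) + (g Fin.zero + - altSumℤ (g ∘ Fin.suc)) ∎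
    where
    open ≡-Reasoning
    interchange : ∀ a b c d → a + b + - (c + d) ≡ (a + - c) + (b + - d)
    interchange = solve-∀

  altSum-* : ∀ {k} (x : ℤ) (f : Fin k → ℤ) → altSumℤ (λ j → x * f j) ≡ x * altSumℤ f
  altSum-* {zero}  x f = sym (ℤP.*-zeroʳ x)
  altSum-* {suc k} x f = begin
    x * f Fin.zero + - altSumℤ (λ j → x * f (Fin.suc j))
      ≡⟨ cong (λ s → x * f Fin.zero + - s) (altSum-* x (f ∘ Fin.suc)) ⟩
    x * f Fin.zero + - (x * altSumℤ (f ∘ Fin.suc))
      ≡⟨ distrib x (f Fin.zero) (altSumℤ (f ∘ Fin.suc)) ⟩
    x * (f Fin.zero + - altSumℤ (f ∘ Fin.suc)) ∎
    where
    open ≡-Reasoning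
    distrib : ∀ x a s → x * a + - (x * s) ≡ x * (a + - s)
    distrib = solve-∀

  altSum-dropLast : ∀ {k} (f : Fin (suc k) → ℤ) → f (fromℕ k) ≡ + 0 →
                    altSumℤ f ≡ altSumℤ (f ∘ inject₁)
  altSum-dropLast {zero}  f f₀≡0 = cong (λ x → x + - + 0) f₀≡0
  altSum-dropLast {suc k} f fₖ≡0 =
    cong (λ s → f Fin.zero + - s) (altSum-dropLast (f ∘ Fin.suc) fₖ≡0)

  minor : ∀ {k} → Matrix ℤ (suc k) (suc k) → Fin (suc k) → Matrix ℤ k k
  minor M j a b = M (Fin.suc a) (punchIn j b)

  det-cong : ∀ {k} {M N : Matrix ℤ k k} → M ≗ᴹ N → detℤ M ≡ detℤ N
  det-cong {zero}  M≗N = refl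
  det-cong {suc k} M≗N = altSum-cong λ j →
    cong₂ _*_ (M≗N Fin.zero j) (det-cong (λ a b → M≗N (Fin.suc a) (punchIn j b)))

  altSum-ℤmod : ∀ q {k} (f : Fin k → ℤ) → altSum (ℤmod q) f ≡ altSumℤ f
  altSum-ℤmod q {zero}  f = refl
  altSum-ℤmod q {suc k} f = cong (λ s → f Fin.zero + - s) (altSum-ℤmod q (f ∘ Fin.suc))

  det-ℤmod : ∀ q {k} (M : Matrix ℤ k k) → det (ℤmod q) M ≡ detℤ M
  det-ℤmod q {zero}  M = refl
  det-ℤmod q {suc k} M = trans (altSum-ℤmod q λ j → M Fin.zero j * det (ℤmod q) (minor M j))
    (altSum-cong λ j → cong (M Fin.zero j *_) (det-ℤmod q (minor M j)))

  isLast : ∀ {k} → Fin (suc k) → Bool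
  isLast {zero}  Fin.zero    = true
  isLast {suc k} Fin.zero    = false
  isLast {suc k} (Fin.suc i) = isLast i

  isLast-inject₁ : ∀ {k} (i : Fin k) → isLast (inject₁ i) ≡ false
  isLast-inject₁ Fin.zero    = refl
  isLast-inject₁ (Fin.suc i) = isLast-inject₁ i

  isLast-punchIn-inject₁ : ∀ {k} (j b : Fin (suc k)) → isLast (punchIn (inject₁ j) b) ≡ isLast b
  isLast-punchIn-inject₁ {zero}  Fin.zero    Fin.zero    = refl
  isLast-punchIn-inject₁ {suc k} Fin.zero    b           = refl
  isLast-punchIn-inject₁ {suc k} (Fin.suc j) Fin.zero    = refl
  isLast-punchIn-inject₁ {suc k} (Fin.suc j) (Fin.suc b) = isLast-punchIn-inject₁ j b

  punchIn-fromℕ : ∀ {k} (b : Fin k) → punchIn (fromℕ k) b ≡ inject₁ b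
  punchIn-fromℕ Fin.zero    = refl
  punchIn-fromℕ (Fin.suc b) = cong Fin.suc (punchIn-fromℕ b)

  punchIn-inject₁-inject₁ : ∀ {k} (j : Fin (suc k)) (b : Fin k) →
                            punchIn (inject₁ j) (inject₁ b) ≡ inject₁ (punchIn j b)
  punchIn-inject₁-inject₁ Fin.zero    b           = refl
  punchIn-inject₁-inject₁ (Fin.suc j) Fin.zero    = refl
  punchIn-inject₁-inject₁ (Fin.suc j) (Fin.suc b) = cong Fin.suc (punchIn-inject₁-inject₁ j b)

  punchIn-inject₁-fromℕ : ∀ {k} (j : Fin (suc k)) →
                          punchIn (inject₁ j) (fromℕ k) ≡ fromℕ (suc k)
  punchIn-inject₁-fromℕ {zero}  Fin.zero    = refl
  punchIn-inject₁-fromℕ {suc k} Fin.zero    = refl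
  punchIn-inject₁-fromℕ {suc k} (Fin.suc j) = cong Fin.suc (punchIn-inject₁-fromℕ j)

  zeroCorner : ∀ {k} → Matrix ℤ (suc k) (suc k) → Matrix ℤ (suc k) (suc k)
  zeroCorner M a b = if isLast a ∧ isLast b then + 0 else M a b

  topLeft : ∀ {k} → Matrix ℤ (suc k) (suc k) → Matrix ℤ k k
  topLeft M a b = M (inject₁ a) (inject₁ b)

  corner : ∀ {k} → Matrix ℤ (suc k) (suc k) → ℤ
  corner {k} M = M (fromℕ k) (fromℕ k)

  minor-zeroCorner-fromℕ : ∀ {k} (M : Matrix ℤ (suc (suc k)) (suc (suc k))) →
                           minor (zeroCorner M) (fromℕ (suc k)) ≗ᴹ minor M (fromℕ (suc k))
  minor-zeroCorner-fromℕ M a b rewrite punchIn-fromℕ b | isLast-inject₁ b | ∧-zeroʳ (isLast a) = refl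

  minor-zeroCorner-inject₁ : ∀ {k} (M : Matrix ℤ (suc (suc k)) (suc (suc k))) j →
                             minor (zeroCorner M) (inject₁ j) ≗ᴹ zeroCorner (minor M (inject₁ j))
  minor-zeroCorner-inject₁ M j a b rewrite isLast-punchIn-inject₁ j b = refl

  topLeft-minor-inject₁ : ∀ {k} (M : Matrix ℤ (suc (suc k)) (suc (suc k))) j →
                          topLeft (minor M (inject₁ j)) ≗ᴹ minor (topLeft M) j
  topLeft-minor-inject₁ M j a b = cong (M (Fin.suc (inject₁ a))) (punchIn-inject₁-inject₁ j b)

  corner-minor-inject₁ : ∀ {k} (M : Matrix ℤ (suc (suc k)) (suc (suc k))) j →
                         corner (minor M (inject₁ j)) ≡ corner M
  corner-minor-inject₁ M j = cong (M (fromℕ _)) (punchIn-inject₁-fromℕ j)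

  -- Expanding along the first row, the minor of the last column does not contain the corner, and every
  -- other minor has the corner of M as its own corner, so induction applies to it.
  det-expandCorner : ∀ {k} (M : Matrix ℤ (suc k) (suc k)) →
                     detℤ M ≡ detℤ (zeroCorner M) + corner M * detℤ (topLeft M)
  det-expandCorner {zero} M = lemma (M Fin.zero Fin.zero)
    where
    lemma : ∀ x → x * + 1 + - + 0 ≡ (+ 0 * + 1 + - + 0) + x * + 1
    lemma = solve-∀
  det-expandCorner {suc k} M = begin
    detℤ M                             ≡⟨ altSum-cong split ⟩
    altSumℤ (λ j → f₀ j + δ j)         ≡⟨ altSum-+ f₀ δ ⟩
    detℤ (zeroCorner M) + altSumℤ δ    ≡⟨ cong (λ s → detℤ (zeroCorner M) + s) altSum-δ ⟩
    detℤ (zeroCorner M) + corner M * detℤ (topLeft M) ∎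
    where
    open ≡-Reasoning
    f₀ δ : Fin (suc (suc k)) → ℤ
    f₀ j = M Fin.zero j * detℤ (minor (zeroCorner M) j)
    δ  j = M Fin.zero j * (detℤ (minor M j) - detℤ (minor (zeroCorner M) j))

    split : ∀ j → M Fin.zero j * detℤ (minor M j) ≡ f₀ j + δ j
    split j = lemma (M Fin.zero j) (detℤ (minor M j)) (detℤ (minor (zeroCorner M) j))
      where
      lemma : ∀ a p q → a * p ≡ a * q + a * (p - q)
      lemma = solve-∀

    δ-last : δ (fromℕ (suc k)) ≡ + 0
    δ-last = begin
      a * (detℤ (minor M last) - detℤ (minor (zeroCorner M) last))
        ≡⟨ cong (λ d → a * (detℤ (minor M last) - d)) (det-cong (minor-zeroCorner-fromℕ M)) ⟩
      a * (detℤ (minor M last) - detℤ (minor M last))   ≡⟨ lemma a (detℤ (minor M last)) ⟩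
      + 0 ∎
      where
      last = fromℕ (suc k)
      a = M Fin.zero last
      lemma : ∀ a d → a * (d - d) ≡ + 0
      lemma = solve-∀

    δ-inject₁ : ∀ j → δ (inject₁ j) ≡ corner M * (topLeft M Fin.zero j * detℤ (minor (topLeft M) j))
    δ-inject₁ j = begin
      a * (detℤ Mⱼ - detℤ (minor (zeroCorner M) (inject₁ j)))
        ≡⟨ cong₂ (λ d e → a * (d - e))
                 (det-expandCorner Mⱼ) (det-cong (minor-zeroCorner-inject₁ M j)) ⟩
      a * ((detℤ (zeroCorner Mⱼ) + corner Mⱼ * detℤ (topLeft Mⱼ)) - detℤ (zeroCorner Mⱼ))
        ≡⟨ cong₂ (λ x d → a * ((detℤ (zeroCorner Mⱼ) + x * d) - detℤ (zeroCorner Mⱼ)))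
                 (corner-minor-inject₁ M j) (det-cong (topLeft-minor-inject₁ M j)) ⟩
      a * ((detℤ (zeroCorner Mⱼ) + corner M * detℤ (minor (topLeft M) j)) - detℤ (zeroCorner Mⱼ))
        ≡⟨ lemma a (detℤ (zeroCorner Mⱼ)) (corner M) (detℤ (minor (topLeft M) j)) ⟩
      corner M * (a * detℤ (minor (topLeft M) j)) ∎
      where
      Mⱼ = minor M (inject₁ j)
      a = M Fin.zero (inject₁ j)
      lemma : ∀ a z x d → a * ((z + x * d) - z) ≡ x * (a * d)
      lemma = solve-∀

    altSum-δ : altSumℤ δ ≡ corner M * detℤ (topLeft M)
    altSum-δ = begin
      altSumℤ δ                  ≡⟨ altSum-dropLast δ δ-last ⟩
      altSumℤ (δ ∘ inject₁)      ≡⟨ altSum-cong δ-inject₁ ⟩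
      altSumℤ (λ j → corner M * firstRowTerm j) ≡⟨ altSum-* (corner M) firstRowTerm ⟩
      corner M * detℤ (topLeft M) ∎
      where
      firstRowTerm : Fin (suc k) → ℤ
      firstRowTerm j = topLeft M Fin.zero j * detℤ (minor (topLeft M) j)

  -- Congruence modulo q

  infix 4 _≋_[mod_]

  record _≋_[mod_] (a b : ℤ) (q : ℕ) : Set where
    constructor mk≋
    field divides : + q ℤDiv.∣ (a - b)

  module _ {q : ℕ} where

    ≋-reflexive : ∀ {a b} → a ≡ b → a ≋ b [mod q ]
    ≋-reflexive {a} refl = mk≋ (ℤDiv.divides (+ 0) (lemma a (+ q)))
      where
      lemma : ∀ a q → a - a ≡ + 0 * q
      lemma = solve-∀

    ≋-refl : ∀ {a} → a ≋ a [mod q ]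
    ≋-refl = ≋-reflexive refl

    ≋-sym : ∀ {a b} → a ≋ b [mod q ] → b ≋ a [mod q ]
    ≋-sym {a} {b} (mk≋ q∣a-b) =
      mk≋ (subst (+ q ℤDiv.∣_) (lemma a b) (ℤDiv.∣m⇒∣-m q∣a-b))
      where
      lemma : ∀ a b → - (a - b) ≡ b - a
      lemma = solve-∀

    ≋-trans : ∀ {a b c} → a ≋ b [mod q ] → b ≋ c [mod q ] → a ≋ c [mod q ]
    ≋-trans {a} {b} {c} (mk≋ q∣a-b) (mk≋ q∣b-c) =
      mk≋ (subst (+ q ℤDiv.∣_) (lemma a b c) (ℤDiv.∣m∣n⇒∣m+n q∣a-b q∣b-c))
      where
      lemma : ∀ a b c → (a - b) + (b - c) ≡ a - c
      lemma = solve-∀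

    +-cong-≋ : ∀ {a b c d} → a ≋ b [mod q ] → c ≋ d [mod q ] → a + c ≋ b + d [mod q ]
    +-cong-≋ {a} {b} {c} {d} (mk≋ q∣a-b) (mk≋ q∣c-d) =
      mk≋ (subst (+ q ℤDiv.∣_) (lemma a b c d) (ℤDiv.∣m∣n⇒∣m+n q∣a-b q∣c-d))
      where
      lemma : ∀ a b c d → (a - b) + (c - d) ≡ (a + c) - (b + d)
      lemma = solve-∀

    *-cong-≋ : ∀ {a b c d} → a ≋ b [mod q ] → c ≋ d [mod q ] → a * c ≋ b * d [mod q ]
    *-cong-≋ {a} {b} {c} {d} (mk≋ q∣a-b) (mk≋ q∣c-d) =
      mk≋ (subst (+ q ℤDiv.∣_) (lemma a b c d)
                 (ℤDiv.∣m∣n⇒∣m+n (ℤDiv.∣m⇒∣m*n c q∣a-b) (ℤDiv.∣n⇒∣m*n b q∣c-d)))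
      where
      lemma : ∀ a b c d → (a - b) * c + b * (c - d) ≡ a * c - b * d
      lemma = solve-∀

    neg-cong-≋ : ∀ {a b} → a ≋ b [mod q ] → - a ≋ - b [mod q ]
    neg-cong-≋ {a} {b} (mk≋ q∣a-b) =
      mk≋ (subst (+ q ℤDiv.∣_) (lemma a b) (ℤDiv.∣m⇒∣-m q∣a-b))
      where
      lemma : ∀ a b → - (a - b) ≡ - a - - b
      lemma = solve-∀

  ≋-setoid : ℕ → Setoid 0ℓ 0ℓ
  ≋-setoid q = record
    { Carrier = ℤ
    ; _≈_ = λ a b → a ≋ b [mod q ]
    ; isEquivalence = record { refl = ≋-refl ; sym = ≋-sym ; trans = ≋-trans }
    }

  module ≋-Reasoning (q : ℕ) = SetoidReasoning (≋-setoid q)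

  ≋-mod0⇒≡ : ∀ {a b} → a ≋ b [mod 0 ] → a ≡ b
  ≋-mod0⇒≡ {a} {b} (mk≋ (ℤDiv.divides t a-b≡t*0)) = begin
    a             ≡⟨ lemma a b ⟩
    (a - b) + b   ≡⟨ cong (_+ b) (trans a-b≡t*0 (ℤP.*-zeroʳ t)) ⟩
    + 0 + b       ≡⟨ ℤP.+-identityˡ b ⟩
    b             ∎
    where
    open ≡-Reasoning
    lemma : ∀ a b → a ≡ (a - b) + b
    lemma = solve-∀

  ≋⇒≡[mod] : ∀ {q a b} → a ≋ b [mod q ] → a ≡ b [mod q ]
  ≋⇒≡[mod] (mk≋ q∣a-b) = ℤDiv.∣⇒∣ᵤ q∣a-b

  ≡[mod]⇒≋ : ∀ {q a b} → a ≡ b [mod q ] → a ≋ b [mod q ]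
  ≡[mod]⇒≋ q∣a-b = mk≋ (ℤDiv.∣ᵤ⇒∣ q∣a-b)

  UnitMod : ℕ → ℤ → Set
  UnitMod q d = Σ ℤ (λ y → d * y ≋ + 1 [mod q ])

  altSum-cong-≋ : ∀ {q k} {f g : Fin k → ℤ} → (∀ j → f j ≋ g j [mod q ]) →
                  altSumℤ f ≋ altSumℤ g [mod q ]
  altSum-cong-≋ {k = zero}  f≋g = ≋-refl
  altSum-cong-≋ {k = suc k} f≋g =
    +-cong-≋ (f≋g Fin.zero) (neg-cong-≋ (altSum-cong-≋ (f≋g ∘ Fin.suc)))

  det-cong-≋ : ∀ {q k} {M N : Matrix ℤ k k} → (∀ a b → M a b ≋ N a b [mod q ]) →
               detℤ M ≋ detℤ N [mod q ]
  det-cong-≋ {k = zero}  M≋N = ≋-refl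
  det-cong-≋ {k = suc k} M≋N = altSum-cong-≋ λ j →
    *-cong-≋ (M≋N Fin.zero j) (det-cong-≋ (λ a b → M≋N (Fin.suc a) (punchIn j b)))

  affine-cancel-≋ : ∀ {q z z′ x x′ p p′} → z ≋ z′ [mod q ] → p ≋ p′ [mod q ] → UnitMod q p →
                    z + x * p ≋ z′ + x′ * p′ [mod q ] → x ≋ x′ [mod q ]
  affine-cancel-≋ {q} {z} {z′} {x} {x′} {p} {p′} z≋z′ p≋p′ (y , py≋1) eq = begin
    x                 ≡⟨ lemma₁ x ⟩
    x * + 1           ≈⟨ *-cong-≋ (≋-refl {a = x}) (≋-sym py≋1) ⟩
    x * (p * y)       ≡⟨ lemma₂ z x p y ⟩
    ((z + x * p) - z) * y  ≈⟨ *-cong-≋ (+-cong-≋ eq (neg-cong-≋ z≋z′)) (≋-refl {a = y}) ⟩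
    ((z′ + x′ * p′) - z′) * y ≡⟨ sym (lemma₂ z′ x′ p′ y) ⟩
    x′ * (p′ * y)     ≈⟨ *-cong-≋ (≋-refl {a = x′}) (*-cong-≋ (≋-sym p≋p′) ≋-refl) ⟩
    x′ * (p * y)      ≈⟨ *-cong-≋ (≋-refl {a = x′}) py≋1 ⟩
    x′ * + 1          ≡⟨ sym (lemma₁ x′) ⟩
    x′                ∎
    where
    open ≋-Reasoning q
    lemma₁ : ∀ x → x ≡ x * + 1
    lemma₁ = solve-∀
    lemma₂ : ∀ z x p y → x * (p * y) ≡ ((z + x * p) - z) * y
    lemma₂ = solve-∀

  -- Border determinants of a grid

  Grid : Set
  Grid = ℕ → ℕ → ℤ

  square : Grid → (a b k : ℕ) → Matrix ℤ k k
  square F a b k i j = F (a ℕ.+ toℕ i) (b ℕ.+ toℕ j)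

  -- The largest square with bottom-right corner (r, c); it starts in row 0 or in column 0.
  borderSquare : Grid → (r c : ℕ) → Matrix ℤ (suc (r ⊓ c)) (suc (r ⊓ c))
  borderSquare F r c = square F (r ∸ r ⊓ c) (c ∸ r ⊓ c) (suc (r ⊓ c))

  borderDet borderDet⁰ cornerCofactor : Grid → ℕ → ℕ → ℤ
  borderDet      F r c = detℤ (borderSquare F r c)
  borderDet⁰     F r c = detℤ (zeroCorner (borderSquare F r c))
  cornerCofactor F r c = detℤ (topLeft (borderSquare F r c))

  borderSquare-corner : ∀ F r c → corner (borderSquare F r c) ≡ F r c
  borderSquare-corner F r c rewrite FinP.toℕ-fromℕ (r ⊓ c) =
    cong₂ F (ℕP.m∸n+n≡m (ℕP.m⊓n≤m r c)) (ℕP.m∸n+n≡m (ℕP.m⊓n≤n r c))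

  borderDet-expandCorner : ∀ F r c → borderDet F r c ≡ borderDet⁰ F r c + F r c * cornerCofactor F r c
  borderDet-expandCorner F r c = trans (det-expandCorner (borderSquare F r c))
    (cong (λ x → borderDet⁰ F r c + x * cornerCofactor F r c) (borderSquare-corner F r c))

  cornerCofactor-suc : ∀ F r c → cornerCofactor F (suc r) (suc c) ≡ borderDet F r c
  cornerCofactor-suc F r c = det-cong {suc (r ⊓ c)} λ i j →
    cong₂ (λ x y → F (r ∸ r ⊓ c ℕ.+ x) (c ∸ r ⊓ c ℕ.+ y))
          (FinP.toℕ-inject₁ i) (FinP.toℕ-inject₁ j)

  cornerCofactor-elim : ∀ (P : ℤ → Set) F r c → P (+ 1) →
                        (∀ r′ c′ → r′ < r → c′ < c → P (borderDet F r′ c′)) →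
                        P (cornerCofactor F r c)
  cornerCofactor-elim P F zero    c       P1 Pprev = P1
  cornerCofactor-elim P F (suc r) zero    P1 Pprev = P1
  cornerCofactor-elim P F (suc r) (suc c) P1 Pprev =
    subst P (sym (cornerCofactor-suc F r c)) (Pprev r c (ℕP.n<1+n r) (ℕP.n<1+n c))

  AgreeUpTo AgreeBefore : ℕ → Grid → Grid → ℕ → ℕ → Set
  AgreeUpTo   q F G r c = ∀ i j → i ≤ r → j ≤ c → F i j ≋ G i j [mod q ]
  AgreeBefore q F G r c = ∀ i j → i ≤ r → j ≤ c → i ℕ.+ j < r ℕ.+ c → F i j ≋ G i j [mod q ]

  isLast≡false⇒< : ∀ {k} (x : Fin (suc k)) → isLast x ≡ false → toℕ x < k
  isLast≡false⇒< {suc k} Fin.zero    _    = ℕP.0<1+n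
  isLast≡false⇒< {suc k} (Fin.suc x) last = ℕ.s≤s (isLast≡false⇒< x last)

  offset-≤ : ∀ {x k r} → x ≤ k → k ≤ r → r ∸ k ℕ.+ x ≤ r
  offset-≤ {x} {k} {r} x≤k k≤r =
    ℕP.≤-trans (ℕP.+-monoʳ-≤ (r ∸ k) x≤k) (ℕP.≤-reflexive (ℕP.m∸n+n≡m k≤r))

  offset-< : ∀ {x k r} → x < k → k ≤ r → r ∸ k ℕ.+ x < r
  offset-< {x} {k} {r} x<k k≤r =
    ℕP.<-≤-trans (ℕP.+-monoʳ-< (r ∸ k) x<k) (ℕP.≤-reflexive (ℕP.m∸n+n≡m k≤r))

  borderSquare-agreeOffCorner : ∀ {q F G r c} → AgreeBefore q F G r c →
                                ∀ x y → isLast x ≡ false ⊎ isLast y ≡ false →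
                                borderSquare F r c x y ≋ borderSquare G r c x y [mod q ]
  borderSquare-agreeOffCorner {r = r} {c} agree x y offCorner =
    agree _ _ (offset-≤ x≤k k≤r) (offset-≤ y≤k k≤c) (antidiagonal offCorner)
    where
    k = r ⊓ c
    k≤r = ℕP.m⊓n≤m r c
    k≤c = ℕP.m⊓n≤n r c
    x≤k = ℕP.≤-pred (FinP.toℕ<n x)
    y≤k = ℕP.≤-pred (FinP.toℕ<n y)
    antidiagonal : isLast x ≡ false ⊎ isLast y ≡ false →
                   (r ∸ k ℕ.+ toℕ x) ℕ.+ (c ∸ k ℕ.+ toℕ y) < r ℕ.+ c
    antidiagonal (inj₁ x-notLast) =
      ℕP.+-mono-<-≤ (offset-< (isLast≡false⇒< x x-notLast) k≤r) (offset-≤ y≤k k≤c)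
    antidiagonal (inj₂ y-notLast) =
      ℕP.+-mono-≤-< (offset-≤ x≤k k≤r) (offset-< (isLast≡false⇒< y y-notLast) k≤c)

  borderDet⁰-local : ∀ {q} F G r c → AgreeBefore q F G r c →
                     borderDet⁰ F r c ≋ borderDet⁰ G r c [mod q ]
  borderDet⁰-local F G r c agree = det-cong-≋ entry
    where
    entry : ∀ x y → zeroCorner (borderSquare F r c) x y ≋ zeroCorner (borderSquare G r c) x y [mod _ ]
    entry x y with isLast x in eqx | isLast y in eqy
    ... | true  | true  = ≋-refl
    ... | false | _     = borderSquare-agreeOffCorner agree x y (inj₁ eqx)
    ... | true  | false = borderSquare-agreeOffCorner agree x y (inj₂ eqy)

  cornerCofactor-local : ∀ {q} F G r c → AgreeBefore q F G r c →
                         cornerCofactor F r c ≋ cornerCofactor G r c [mod q ]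
  cornerCofactor-local F G r c agree = det-cong-≋ λ x y →
    borderSquare-agreeOffCorner agree (inject₁ x) (inject₁ y) (inj₁ (isLast-inject₁ x))

  borderDet-local : ∀ {q} F G r c → AgreeUpTo q F G r c → borderDet F r c ≋ borderDet G r c [mod q ]
  borderDet-local {q} F G r c agree = begin
    borderDet F r c                                    ≡⟨ borderDet-expandCorner F r c ⟩
    borderDet⁰ F r c + F r c * cornerCofactor F r c
      ≈⟨ +-cong-≋ (borderDet⁰-local F G r c before)
                  (*-cong-≋ (agree r c ℕP.≤-refl ℕP.≤-refl) (cornerCofactor-local F G r c before)) ⟩
    borderDet⁰ G r c + G r c * cornerCofactor G r c   ≡⟨ borderDet-expandCorner G r c ⟨
    borderDet G r c                                    ∎
    where
    open ≋-Reasoning q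
    before : AgreeBefore q F G r c
    before i j i≤r j≤c _ = agree i j i≤r j≤c

  antidiagonal-rec : (P : ℕ → ℕ → Set) → (∀ r c → (∀ i j → i ℕ.+ j < r ℕ.+ c → P i j) → P r c) →
                     ∀ r c → P r c
  antidiagonal-rec P step r c = <-rec (λ t → ∀ r c → r ℕ.+ c ≡ t → P r c) go (r ℕ.+ c) r c refl
    where
    go : ∀ t → (∀ {s} → s < t → ∀ r c → r ℕ.+ c ≡ s → P r c) → ∀ r c → r ℕ.+ c ≡ t → P r c
    go _ rec r c refl = step r c λ i j i+j<r+c → rec i+j<r+c i j refl

  entries-determined-by-borderDets : ∀ q (F G : Grid) n m →
    (∀ r c → r < n → c < m → borderDet F r c ≋ borderDet G r c [mod q ]) →
    (∀ r c → r < n → c < m → UnitMod q (borderDet F r c)) →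
    ∀ r c → r < n → c < m → F r c ≋ G r c [mod q ]
  entries-determined-by-borderDets q F G n m dets≋ units = antidiagonal-rec _ step
    where
    step : ∀ r c → (∀ i j → i ℕ.+ j < r ℕ.+ c → i < n → j < m → F i j ≋ G i j [mod q ]) →
           r < n → c < m → F r c ≋ G r c [mod q ]
    step r c ih r<n c<m = affine-cancel-≋
      (borderDet⁰-local F G r c before) (cornerCofactor-local F G r c before) cofactor-unit
      (≋-trans (≋-reflexive (sym (borderDet-expandCorner F r c)))
               (≋-trans (dets≋ r c r<n c<m) (≋-reflexive (borderDet-expandCorner G r c))))
      where
      before : AgreeBefore q F G r c
      before i j i≤r j≤c i+j<r+c =
        ih i j i+j<r+c (ℕP.≤-<-trans i≤r r<n) (ℕP.≤-<-trans j≤c c<m)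
      cofactor-unit : UnitMod q (cornerCofactor F r c)
      cofactor-unit = cornerCofactor-elim (UnitMod q) F r c (+ 1 , ≋-refl)
        λ r′ c′ r′<r c′<c → units r′ c′ (ℕP.<-trans r′<r r<n) (ℕP.<-trans c′<c c<m)

  module _ (σ : Grid) (σ²≡1 : ∀ r c → σ r c * σ r c ≡ + 1) where

    -- Solves borderDet⁰ + x · cofactor = σ for x: the cofactor is ±1, hence its own inverse.
    nextEntry : Grid → ℕ → ℕ → ℤ
    nextEntry G r c = (σ r c - borderDet⁰ G r c) * cornerCofactor G r c

    fillAntidiagonal : ℕ → Grid → Grid
    fillAntidiagonal t G r c with r ℕ.+ c ℕ.≟ t
    ... | yes _ = nextEntry G r c
    ... | no  _ = G r c

    fillAntidiagonal-on : ∀ {t} G r c → r ℕ.+ c ≡ t → fillAntidiagonal t G r c ≡ nextEntry G r c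
    fillAntidiagonal-on {t} G r c r+c≡t with r ℕ.+ c ℕ.≟ t
    ... | yes _       = refl
    ... | no  r+c≢t   = ⊥-elim (r+c≢t r+c≡t)

    fillAntidiagonal-off : ∀ {t} G r c → r ℕ.+ c ≢ t → fillAntidiagonal t G r c ≡ G r c
    fillAntidiagonal-off {t} G r c r+c≢t with r ℕ.+ c ℕ.≟ t
    ... | yes r+c≡t = ⊥-elim (r+c≢t r+c≡t)
    ... | no  _     = refl

    filledBelow : ℕ → Grid
    filledBelow zero    _ _ = + 0
    filledBelow (suc t)     = fillAntidiagonal t (filledBelow t)

    fillAntidiagonal-borderDet : ∀ {t} G r c → r ℕ.+ c ≡ t →
                                 cornerCofactor G r c * cornerCofactor G r c ≡ + 1 →
                                 borderDet (fillAntidiagonal t G) r c ≡ σ r c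
    fillAntidiagonal-borderDet {t} G r c r+c≡t p²≡1 = begin
      borderDet H r c                                 ≡⟨ borderDet-expandCorner H r c ⟩
      borderDet⁰ H r c + H r c * cornerCofactor H r c ≡⟨ cong₂ (λ z p → z + H r c * p) z≡ p≡ ⟩
      z + H r c * p
        ≡⟨ cong (λ x → z + x * p) (fillAntidiagonal-on G r c r+c≡t) ⟩
      z + ((σ r c - z) * p) * p                       ≡⟨ lemma₁ z (σ r c) p ⟩
      z + (σ r c - z) * (p * p)                       ≡⟨ cong (λ u → z + (σ r c - z) * u) p²≡1 ⟩
      z + (σ r c - z) * + 1                           ≡⟨ lemma₂ z (σ r c) ⟩
      σ r c                                           ∎
      where
      open ≡-Reasoning
      H = fillAntidiagonal t G
      z = borderDet⁰ G r c
      p = cornerCofactor G r c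
      unchanged : AgreeBefore 0 H G r c
      unchanged i j _ _ i+j<r+c =
        ≋-reflexive (fillAntidiagonal-off G i j λ i+j≡t →
          ℕP.<-irrefl (trans i+j≡t (sym r+c≡t)) i+j<r+c)
      z≡ : borderDet⁰ H r c ≡ z
      z≡ = ≋-mod0⇒≡ (borderDet⁰-local H G r c unchanged)
      p≡ : cornerCofactor H r c ≡ p
      p≡ = ≋-mod0⇒≡ (cornerCofactor-local H G r c unchanged)
      lemma₁ : ∀ z s p → z + ((s - z) * p) * p ≡ z + (s - z) * (p * p)
      lemma₁ = solve-∀
      lemma₂ : ∀ z s → z + (s - z) * + 1 ≡ s
      lemma₂ = solve-∀

    fillAntidiagonal-borderDet-before : ∀ {t} G r c → r ℕ.+ c < t →
                                        borderDet (fillAntidiagonal t G) r c ≡ borderDet G r c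
    fillAntidiagonal-borderDet-before {t} G r c r+c<t =
      ≋-mod0⇒≡ (borderDet-local _ G r c λ i j i≤r j≤c →
        ≋-reflexive (fillAntidiagonal-off G i j λ i+j≡t →
          ℕP.<-irrefl i+j≡t (ℕP.≤-<-trans (ℕP.+-mono-≤ i≤r j≤c) r+c<t)))

    filledBelow-borderDet : ∀ t r c → r ℕ.+ c < t → borderDet (filledBelow t) r c ≡ σ r c
    filledBelow-borderDet (suc t) r c r+c<1+t with ℕP.m≤n⇒m<n∨m≡n (ℕP.≤-pred r+c<1+t)
    ... | inj₁ r+c<t = trans (fillAntidiagonal-borderDet-before (filledBelow t) r c r+c<t)
                             (filledBelow-borderDet t r c r+c<t)
    ... | inj₂ r+c≡t = fillAntidiagonal-borderDet (filledBelow t) r c r+c≡t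
      (cornerCofactor-elim (λ p → p * p ≡ + 1) (filledBelow t) r c refl λ r′ c′ r′<r c′<c →
        trans (cong (λ d → d * d) (filledBelow-borderDet t r′ c′ (earlier r′<r c′<c)))
              (σ²≡1 r′ c′))
      where
      earlier : ∀ {r′ c′} → r′ < r → c′ < c → r′ ℕ.+ c′ < t
      earlier r′<r c′<c = subst (_ <_) r+c≡t (ℕP.+-mono-≤-< (ℕP.<⇒≤ r′<r) c′<c)

  -- Matrices as grids

  -- Padding by 1 turns a matrix of signs into a grid of signs; elsewhere the padding is never looked at.
  extend : ∀ {n m} → Matrix ℤ n m → Grid
  extend {n} {m} M r c with r ℕ.<? n | c ℕ.<? m
  ... | yes r<n | yes c<m = M (fromℕ< r<n) (fromℕ< c<m)
  ... | _       | _       = + 1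

  extend-inside : ∀ {n m r c} (M : Matrix ℤ n m) (r<n : r < n) (c<m : c < m) →
                  extend M r c ≡ M (fromℕ< r<n) (fromℕ< c<m)
  extend-inside {n} {m} {r} {c} M r<n c<m with r ℕ.<? n | c ℕ.<? m
  ... | yes _ | yes _   = refl
  ... | yes _ | no c≮m  = ⊥-elim (c≮m c<m)
  ... | no r≮n | _      = ⊥-elim (r≮n r<n)

  extend-toℕ : ∀ {n m} (M : Matrix ℤ n m) i j → extend M (toℕ i) (toℕ j) ≡ M i j
  extend-toℕ M i j = trans (extend-inside M (FinP.toℕ<n i) (FinP.toℕ<n j))
    (cong₂ M (FinP.fromℕ<-toℕ i (FinP.toℕ<n i)) (FinP.fromℕ<-toℕ j (FinP.toℕ<n j)))

  extend-square≡1 : ∀ {n m} (M : Matrix ℤ n m) → (∀ i j → M i j * M i j ≡ + 1) →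
                    ∀ r c → extend M r c * extend M r c ≡ + 1
  extend-square≡1 {n} {m} M M²≡1 r c with r ℕ.<? n | c ℕ.<? m
  ... | yes r<n | yes c<m = M²≡1 _ _
  ... | yes _   | no _    = refl
  ... | no _    | _       = refl

  borderDets : ∀ {n m} → Matrix ℤ n m → Matrix ℤ n m
  borderDets M i j = borderDet (extend M) (toℕ i) (toℕ j)

  borderDets-fromℕ< : ∀ {n m r c} (M : Matrix ℤ n m) (r<n : r < n) (c<m : c < m) →
                      borderDets M (fromℕ< r<n) (fromℕ< c<m) ≡ borderDet (extend M) r c
  borderDets-fromℕ< M r<n c<m =
    cong₂ (borderDet (extend M)) (FinP.toℕ-fromℕ< r<n) (FinP.toℕ-fromℕ< c<m)

  borderDet-square : ∀ F a b k → a ⊓ b ≡ 0 →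
                     borderDet F (a ℕ.+ k) (b ℕ.+ k) ≡ detℤ (square F a b (suc k))
  borderDet-square F a b k a⊓b≡0
    rewrite sym (ℕP.+-distribʳ-⊓ k a b) | a⊓b≡0 | ℕP.m+n∸n≡m a k | ℕP.m+n∸n≡m b k = refl

  upperSub-square : ∀ {n m} (M : Matrix ℤ n m) k j k≤n jk≤m →
                    upperSub ℤ-rawRing M k j k≤n jk≤m ≗ᴹ square (extend M) 0 j k
  upperSub-square M k j k≤n jk≤m a b = sym (extend-inside M
    (ℕP.<-≤-trans (FinP.toℕ<n a) k≤n) (ℕP.<-≤-trans (ℕP.+-monoʳ-< j (FinP.toℕ<n b)) jk≤m))

  leftSub-square : ∀ {n m} (M : Matrix ℤ n m) k i ik≤n k≤m →
                   leftSub ℤ-rawRing M k i ik≤n k≤m ≗ᴹ square (extend M) i 0 k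
  leftSub-square M k i ik≤n k≤m a b = sym (extend-inside M
    (ℕP.<-≤-trans (ℕP.+-monoʳ-< i (FinP.toℕ<n a)) ik≤n) (ℕP.<-≤-trans (FinP.toℕ<n b) k≤m))

  borderDet-upper : ∀ F k j → borderDet F k (j ℕ.+ k) ≡ detℤ (square F 0 j (suc k))
  borderDet-upper F k j = borderDet-square F 0 j k refl

  borderDet-left : ∀ F k i → borderDet F (i ℕ.+ k) k ≡ detℤ (square F i 0 (suc k))
  borderDet-left F k i = borderDet-square F i 0 k (ℕP.⊓-zeroʳ i)

  BorderMinors : ∀ {n m} → (ℤ → Set) → Matrix ℤ n m → Set
  BorderMinors {n} {m} P M =
    (∀ k j → 1 ≤ k → (k≤n : k ≤ n) (jk≤m : j ℕ.+ k ≤ m) →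
       P (detℤ (upperSub ℤ-rawRing M k j k≤n jk≤m)))
    × (∀ k i → 1 ≤ k → (ik≤n : i ℕ.+ k ≤ n) (k≤m : k ≤ m) →
       P (detℤ (leftSub ℤ-rawRing M k i ik≤n k≤m)))

  module _ {n m : ℕ} {P : ℤ → Set} (M : Matrix ℤ n m) where

    BorderMinors⇒borderDets : BorderMinors P M → ∀ i j → P (borderDets M i j)
    BorderMinors⇒borderDets (upper , left) i j with toℕ i | toℕ j | FinP.toℕ<n i | FinP.toℕ<n j
    ... | r | c | r<n | c<m with ℕP.≤-total r c
    ... | inj₁ r≤c = subst P upper≡ (upper (suc r) (c ∸ r) (ℕ.s≤s ℕ.z≤n) r<n fits)
      where
      c∸r+r≡c = ℕP.m∸n+n≡m r≤c
      fits : c ∸ r ℕ.+ suc r ≤ m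
      fits = subst (_≤ m) (sym (trans (ℕP.+-suc (c ∸ r) r) (cong suc c∸r+r≡c))) c<m
      upper≡ : detℤ (upperSub ℤ-rawRing M (suc r) (c ∸ r) r<n fits) ≡ borderDet (extend M) r c
      upper≡ = trans (det-cong (upperSub-square M _ _ r<n fits))
        (trans (sym (borderDet-upper (extend M) r (c ∸ r))) (cong (borderDet (extend M) r) c∸r+r≡c))
    ... | inj₂ c≤r = subst P left≡ (left (suc c) (r ∸ c) (ℕ.s≤s ℕ.z≤n) fits c<m)
      where
      r∸c+c≡r = ℕP.m∸n+n≡m c≤r
      fits : r ∸ c ℕ.+ suc c ≤ n
      fits = subst (_≤ n) (sym (trans (ℕP.+-suc (r ∸ c) c) (cong suc r∸c+c≡r))) r<n
      left≡ : detℤ (leftSub ℤ-rawRing M (suc c) (r ∸ c) fits c<m) ≡ borderDet (extend M) r c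
      left≡ = trans (det-cong (leftSub-square M _ _ fits c<m))
        (trans (sym (borderDet-left (extend M) c (r ∸ c)))
               (cong (λ r → borderDet (extend M) r c) r∸c+c≡r))

    borderDets⇒BorderMinors : (∀ i j → P (borderDets M i j)) → BorderMinors P M
    borderDets⇒BorderMinors dets = upper , left
      where
      upper : ∀ k j → 1 ≤ k → (k≤n : k ≤ n) (jk≤m : j ℕ.+ k ≤ m) →
              P (detℤ (upperSub ℤ-rawRing M k j k≤n jk≤m))
      upper (suc k) j _ k<n jk<m = subst P upper≡ (dets (fromℕ< k<n) (fromℕ< j+k<m))
        where
        j+k<m = subst (_≤ m) (ℕP.+-suc j k) jk<m
        upper≡ : borderDets M (fromℕ< k<n) (fromℕ< j+k<m) ≡ detℤ (upperSub ℤ-rawRing M (suc k) j k<n jk<m)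
        upper≡ = trans (borderDets-fromℕ< M k<n j+k<m)
          (trans (borderDet-upper (extend M) k j) (sym (det-cong (upperSub-square M _ _ k<n jk<m))))
      left : ∀ k i → 1 ≤ k → (ik≤n : i ℕ.+ k ≤ n) (k≤m : k ≤ m) →
             P (detℤ (leftSub ℤ-rawRing M k i ik≤n k≤m))
      left (suc k) i _ ik<n k<m = subst P left≡ (dets (fromℕ< i+k<n) (fromℕ< k<m))
        where
        i+k<n = subst (_≤ n) (ℕP.+-suc i k) ik<n
        left≡ : borderDets M (fromℕ< i+k<n) (fromℕ< k<m) ≡ detℤ (leftSub ℤ-rawRing M (suc k) i ik<n k<m)
        left≡ = trans (borderDets-fromℕ< M i+k<n k<m)
          (trans (borderDet-left (extend M) k i) (sym (det-cong (leftSub-square M _ _ ik<n k<m))))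

  borderDets-cong : ∀ {n m} {M N : Matrix ℤ n m} → M ≗ᴹ N → borderDets M ≗ᴹ borderDets N
  borderDets-cong {n} {m} {M} {N} M≗N i j =
    ≋-mod0⇒≡ (borderDet-local _ _ (toℕ i) (toℕ j) λ r c _ _ → ≋-reflexive (extend-cong r c))
    where
    extend-cong : ∀ r c → extend M r c ≡ extend N r c
    extend-cong r c with r ℕ.<? n | c ℕ.<? m
    ... | yes _ | yes _ = M≗N _ _
    ... | yes _ | no _  = refl
    ... | no _  | _     = refl

  module _ {n m : ℕ} where

    borderDets-determine-entries : ∀ q (M N : Matrix ℤ n m) →
      (∀ i j → borderDets M i j ≋ borderDets N i j [mod q ]) →
      (∀ i j → UnitMod q (borderDets M i j)) →
      ∀ i j → M i j ≋ N i j [mod q ]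
    borderDets-determine-entries q M N dets≋ units i j =
      subst₂ (λ x y → x ≋ y [mod q ]) (extend-toℕ M i j) (extend-toℕ N i j)
        (entries-determined-by-borderDets q (extend M) (extend N) n m gridDets≋ gridUnits
          (toℕ i) (toℕ j) (FinP.toℕ<n i) (FinP.toℕ<n j))
      where
      gridDets≋ : ∀ r c → r < n → c < m →
                  borderDet (extend M) r c ≋ borderDet (extend N) r c [mod q ]
      gridDets≋ r c r<n c<m = subst₂ (λ x y → x ≋ y [mod q ])
        (borderDets-fromℕ< M r<n c<m) (borderDets-fromℕ< N r<n c<m) (dets≋ (fromℕ< r<n) (fromℕ< c<m))
      gridUnits : ∀ r c → r < n → c < m → UnitMod q (borderDet (extend M) r c)
      gridUnits r c r<n c<m =
        subst (UnitMod q) (borderDets-fromℕ< M r<n c<m) (units (fromℕ< r<n) (fromℕ< c<m))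

    realise : (σ : Matrix ℤ n m) → (∀ i j → σ i j * σ i j ≡ + 1) → Matrix ℤ n m
    realise σ σ²≡1 i j =
      filledBelow (extend σ) (extend-square≡1 σ σ²≡1) (n ℕ.+ m) (toℕ i) (toℕ j)

    borderDets-realise : ∀ σ σ²≡1 → borderDets (realise σ σ²≡1) ≗ᴹ σ
    borderDets-realise σ σ²≡1 i j = begin
      borderDet (extend (realise σ σ²≡1)) (toℕ i) (toℕ j)
        ≡⟨ ≋-mod0⇒≡ (borderDet-local _ _ _ _ agree) ⟩
      borderDet G (toℕ i) (toℕ j)
        ≡⟨ filledBelow-borderDet (extend σ) (extend-square≡1 σ σ²≡1) (n ℕ.+ m) (toℕ i) (toℕ j)
             (ℕP.+-mono-< (FinP.toℕ<n i) (FinP.toℕ<n j)) ⟩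
      extend σ (toℕ i) (toℕ j)                              ≡⟨ extend-toℕ σ i j ⟩
      σ i j                                                 ∎
      where
      open ≡-Reasoning
      G = filledBelow (extend σ) (extend-square≡1 σ σ²≡1) (n ℕ.+ m)
      agree : AgreeUpTo 0 (extend (realise σ σ²≡1)) G (toℕ i) (toℕ j)
      agree r c r≤i c≤j = ≋-reflexive (trans (extend-inside _ r<n c<m)
        (cong₂ G (FinP.toℕ-fromℕ< r<n) (FinP.toℕ-fromℕ< c<m)))
        where
        r<n = ℕP.≤-<-trans r≤i (FinP.toℕ<n i)
        c<m = ℕP.≤-<-trans c≤j (FinP.toℕ<n j)

  -- Signs and units

  data Sign : ℤ → Set where
    plus  : Sign (+ 1)
    minus : Sign (- + 1)

  Sign-square : ∀ {d} → Sign d → d * d ≡ + 1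
  Sign-square plus  = refl
  Sign-square minus = refl

  Sign-odd : ∀ {d} → Sign d → d ≋ + 1 [mod 2 ]
  Sign-odd plus  = ≋-refl
  Sign-odd minus = mk≋ (ℤDiv.divides (- + 1) refl)

  ∣d∣≡1⇒Sign : ∀ d → ∣ d ∣ ≡ 1 → Sign d
  ∣d∣≡1⇒Sign (+ 1)      _ = plus
  ∣d∣≡1⇒Sign -[1+ 0 ]   _ = minus
  ∣d∣≡1⇒Sign (+ 0)          ()
  ∣d∣≡1⇒Sign (+ suc (suc _)) ()
  ∣d∣≡1⇒Sign -[1+ suc _ ]    ()

  unit⇒Sign : ∀ {d y} → d * y ≡ + 1 → Sign d
  unit⇒Sign {d} {y} dy≡1 =
    ∣d∣≡1⇒Sign d (ℕP.m*n≡1⇒m≡1 ∣ d ∣ ∣ y ∣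
                   (trans (sym (ℤP.abs-* d y)) (cong ∣_∣ dy≡1)))

  signOf : Fin 2 → ℤ
  signOf Fin.zero       = + 1
  signOf (Fin.suc _)    = - + 1

  Sign-signOf : ∀ b → Sign (signOf b)
  Sign-signOf Fin.zero             = plus
  Sign-signOf (Fin.suc Fin.zero)   = minus

  signOf-injective : ∀ {a b} → signOf a ≡ signOf b → a ≡ b
  signOf-injective {Fin.zero}           {Fin.zero}           _  = refl
  signOf-injective {Fin.suc Fin.zero}   {Fin.suc Fin.zero}   _  = refl
  signOf-injective {Fin.zero}           {Fin.suc Fin.zero}   ()
  signOf-injective {Fin.suc Fin.zero}   {Fin.zero}           ()

  signIndex : ∀ {d} → Sign d → Fin 2
  signIndex plus  = Fin.zero
  signIndex minus = Fin.suc Fin.zero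

  signOf-signIndex : ∀ {d} (s : Sign d) → signOf (signIndex s) ≡ d
  signOf-signIndex plus  = refl
  signOf-signIndex minus = refl

  _≋?_[mod_] : ∀ a b q → Dec (a ≋ b [mod q ])
  a ≋? b [mod q ] =
    map′ (mk≋ ∘ ℤDiv.∣ᵤ⇒∣) (λ (mk≋ q∣a-b) → ℤDiv.∣⇒∣ᵤ q∣a-b) (q ℕDiv.∣? ∣ a - b ∣)

  SignModulo : ℕ → ℤ → Set
  SignModulo q d = Σ ℤ λ s → Sign s × d ≋ s [mod q ]

  ResidueUnitsAreSigns : ℕ → Set
  ResidueUnitsAreSigns q = ∀ (ρ ρ′ : Fin q) → + toℕ ρ * + toℕ ρ′ ≋ + 1 [mod q ] →
                           + toℕ ρ ≋ + 1 [mod q ] ⊎ + toℕ ρ ≋ - + 1 [mod q ]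

  residueUnitsAreSigns? : ∀ q → Dec (ResidueUnitsAreSigns q)
  residueUnitsAreSigns? q = FinP.all? λ ρ → FinP.all? λ ρ′ →
    (_ ≋? _ [mod q ]) →-dec ((_ ≋? _ [mod q ]) ⊎-dec (_ ≋? _ [mod q ]))

  residue : ∀ q .{{_ : ℕ.NonZero q}} → ℤ → Fin q
  residue q d = fromℕ< (ℤDivMod.n%ℕd<d d q)

  ≋-residue : ∀ q .{{_ : ℕ.NonZero q}} d → d ≋ + toℕ (residue q d) [mod q ]
  ≋-residue q d rewrite FinP.toℕ-fromℕ< (ℤDivMod.n%ℕd<d d q) =
    mk≋ (ℤDiv.divides t (trans (cong (_- ρ) (ℤDivMod.a≡a%ℕn+[a/ℕn]*n d q)) (lemma ρ t (+ q))))
    where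
    ρ = + (d ℤDivMod.%ℕ q)
    t = d ℤDivMod./ℕ q
    lemma : ∀ ρ t q → (ρ + t * q) - ρ ≡ t * q
    lemma = solve-∀

  unitsMod-areSigns : ∀ q .{{_ : ℕ.NonZero q}} → ResidueUnitsAreSigns q →
                      ∀ d → UnitMod q d → SignModulo q d
  unitsMod-areSigns q residueUnits d (y , dy≋1) = sign (residueUnits (residue q d) (residue q y) ρρ′≋1)
    where
    ρρ′≋1 = ≋-trans (≋-sym (*-cong-≋ (≋-residue q d) (≋-residue q y))) dy≋1
    ρ = + toℕ (residue q d)
    sign : ρ ≋ + 1 [mod q ] ⊎ ρ ≋ - + 1 [mod q ] → SignModulo q d
    sign (inj₁ ρ≋1)  = + 1   , plus  , ≋-trans (≋-residue q d) ρ≋1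
    sign (inj₂ ρ≋-1) = - + 1 , minus , ≋-trans (≋-residue q d) ρ≋-1

  unitsMod-3-4-6-areSigns : ∀ q → q ≡ 3 ⊎ q ≡ 4 ⊎ q ≡ 6 → ∀ d → UnitMod q d → SignModulo q d
  unitsMod-3-4-6-areSigns _ (inj₁ refl)        = unitsMod-areSigns 3 (from-yes (residueUnitsAreSigns? 3))
  unitsMod-3-4-6-areSigns _ (inj₂ (inj₁ refl)) = unitsMod-areSigns 4 (from-yes (residueUnitsAreSigns? 4))
  unitsMod-3-4-6-areSigns _ (inj₂ (inj₂ refl)) = unitsMod-areSigns 6 (from-yes (residueUnitsAreSigns? 6))

  Sign⇒UnitMod : ∀ {q d} → Sign d → UnitMod q d
  Sign⇒UnitMod {d = d} s = d , ≋-reflexive (Sign-square s)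

  -- Pascal-like matrices

  module _ {n m : ℕ} (M : Matrix ℤ n m) where

    PascalLike⇒borderDets-signs : PascalLike ℤ-rawRing M → ∀ i j → Sign (borderDets M i j)
    PascalLike⇒borderDets-signs pascal i j =
      unit⇒Sign (proj₂ (BorderMinors⇒borderDets {P = IsUnit ℤ-rawRing} M pascal i j))

    borderDets-signs⇒PascalLike : (∀ i j → Sign (borderDets M i j)) → PascalLike ℤ-rawRing M
    borderDets-signs⇒PascalLike signs = borderDets⇒BorderMinors {P = IsUnit ℤ-rawRing} M λ i j →
      borderDets M i j , Sign-square (signs i j)

    PascalLike-mod⇒borderDets-units : ∀ q → PascalLike (ℤmod q) M →
                                      ∀ i j → UnitMod q (borderDets M i j)
    PascalLike-mod⇒borderDets-units q (upper , left) = BorderMinors⇒borderDets {P = UnitMod q} M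
      ( (λ k j 1≤k k≤n jk≤m → toUnitMod (upperSub ℤ-rawRing M k j k≤n jk≤m) (upper k j 1≤k k≤n jk≤m))
      , (λ k i 1≤k ik≤n k≤m → toUnitMod (leftSub ℤ-rawRing M k i ik≤n k≤m) (left k i 1≤k ik≤n k≤m))
      )
      where
      toUnitMod : ∀ {k} (A : Matrix ℤ k k) → IsUnit (ℤmod q) (det (ℤmod q) A) → UnitMod q (detℤ A)
      toUnitMod A (y , Ay≡1) = y , subst (λ d → d * y ≋ + 1 [mod q ]) (det-ℤmod q A) (≡[mod]⇒≋ Ay≡1)

  module _ {n m : ℕ} where

    PascalLike-congruent-mod2 : ∀ (M N : Matrix ℤ n m) → PascalLike ℤ-rawRing M → PascalLike ℤ-rawRing N →
                                ∀ i j → M i j ≋ N i j [mod 2 ]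
    PascalLike-congruent-mod2 M N pascalM pascalN = borderDets-determine-entries 2 M N
      (λ i j → ≋-trans (Sign-odd (signsM i j)) (≋-sym (Sign-odd (signsN i j))))
      (λ i j → Sign⇒UnitMod (signsM i j))
      where
      signsM = PascalLike⇒borderDets-signs M pascalM
      signsN = PascalLike⇒borderDets-signs N pascalN

    PascalLike-mod-lift : ∀ q (M : Matrix ℤ n m) → (∀ d → UnitMod q d → SignModulo q d) →
                          PascalLike (ℤmod q) M →
                          Σ (Matrix ℤ n m) λ N → PascalLike ℤ-rawRing N × (∀ i j → M i j ≋ N i j [mod q ])
    PascalLike-mod-lift q M unitsAreSigns pascal =
      N , pascalN , borderDets-determine-entries q M N dets≋ units
      where
      units = PascalLike-mod⇒borderDets-units M q pascal
      σ : Matrix ℤ n m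
      σ i j = proj₁ (unitsAreSigns _ (units i j))
      σ-sign : ∀ i j → Sign (σ i j)
      σ-sign i j = proj₁ (proj₂ (unitsAreSigns _ (units i j)))
      σ²≡1 : ∀ i j → σ i j * σ i j ≡ + 1
      σ²≡1 i j = Sign-square (σ-sign i j)
      N = realise σ σ²≡1
      pascalN = borderDets-signs⇒PascalLike N λ i j →
        subst Sign (sym (borderDets-realise σ σ²≡1 i j)) (σ-sign i j)
      dets≋ : ∀ i j → borderDets M i j ≋ borderDets N i j [mod q ]
      dets≋ i j = ≋-trans (proj₂ (proj₂ (unitsAreSigns _ (units i j))))
                          (≋-reflexive (sym (borderDets-realise σ σ²≡1 i j)))

  funToFin-cong : ∀ {k l} {f g : Fin k → Fin l} → (∀ i → f i ≡ g i) → funToFin f ≡ funToFin g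
  funToFin-cong {zero}  f≗g = refl
  funToFin-cong {suc k} f≗g = cong₂ combine (f≗g Fin.zero) (funToFin-cong (f≗g ∘ Fin.suc))

  finToFun-injective : ∀ {k l} {x y : Fin (l ℕ.^ k)} →
                       (∀ i → finToFun {l} {k} x i ≡ finToFun y i) → x ≡ y
  finToFun-injective {k} {l} {x} {y} eq = begin
    x                                       ≡⟨ FinP.funToFin-finToFin {k} {l} x ⟨
    funToFin {k} {l} (finToFun {l} {k} x)   ≡⟨ funToFin-cong eq ⟩
    funToFin {k} {l} (finToFun {l} {k} y)   ≡⟨ FinP.funToFin-finToFin {k} {l} y ⟩
    y                                       ∎
    where open ≡-Reasoning

  module _ {n m : ℕ} where

    -- A Pascal-like matrix is coded by the signs of its border determinants, one bit per entry.
    signMatrix : Fin (2 ℕ.^ (n ℕ.* m)) → Matrix ℤ n m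
    signMatrix x i j = signOf (finToFun {2} {n ℕ.* m} x (combine i j))

    signMatrix-sign : ∀ x i j → Sign (signMatrix x i j)
    signMatrix-sign x i j = Sign-signOf (finToFun {2} {n ℕ.* m} x (combine i j))

    signMatrix-square : ∀ x i j → signMatrix x i j * signMatrix x i j ≡ + 1
    signMatrix-square x i j = Sign-square (signMatrix-sign x i j)

    pascalMatrix : Fin (2 ℕ.^ (n ℕ.* m)) → Matrix ℤ n m
    pascalMatrix x = realise (signMatrix x) (signMatrix-square x)

    borderDets-pascalMatrix : ∀ x → borderDets (pascalMatrix x) ≗ᴹ signMatrix x
    borderDets-pascalMatrix x = borderDets-realise (signMatrix x) (signMatrix-square x)

    pascalMatrix-PascalLike : ∀ x → PascalLike ℤ-rawRing (pascalMatrix x)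
    pascalMatrix-PascalLike x = borderDets-signs⇒PascalLike (pascalMatrix x) λ i j →
      subst Sign (sym (borderDets-pascalMatrix x i j)) (signMatrix-sign x i j)

    signMatrix-injective : ∀ {x y} → signMatrix x ≗ᴹ signMatrix y → x ≡ y
    signMatrix-injective {x} {y} eq = finToFun-injective {n ℕ.* m} {2} λ idx →
      subst (λ idx → finToFun {2} {n ℕ.* m} x idx ≡ finToFun y idx) (FinP.combine-remQuot {n} m idx)
        (signOf-injective (eq (proj₁ (remQuot {n} m idx)) (proj₂ (remQuot {n} m idx))))

    pascalMatrix-injective : ∀ {x y} → pascalMatrix x ≗ᴹ pascalMatrix y → x ≡ y
    pascalMatrix-injective {x} {y} eq = signMatrix-injective λ i j →
      trans (sym (borderDets-pascalMatrix x i j))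
            (trans (borderDets-cong eq i j) (borderDets-pascalMatrix y i j))

    pascalMatrix-surjective : ∀ M → PascalLike ℤ-rawRing M →
                              Σ (Fin (2 ℕ.^ (n ℕ.* m))) λ x → M ≗ᴹ pascalMatrix x
    pascalMatrix-surjective M pascal =
      x , λ i j → ≋-mod0⇒≡ (borderDets-determine-entries 0 M (pascalMatrix x) dets≋ units i j)
      where
      signs = PascalLike⇒borderDets-signs M pascal
      code : Fin (n ℕ.* m) → Fin 2
      code idx = signIndex (signs (proj₁ (remQuot {n} m idx)) (proj₂ (remQuot {n} m idx)))
      x = funToFin code
      signMatrix-x : ∀ i j → signMatrix x i j ≡ borderDets M i j
      signMatrix-x i j = begin
        signOf (finToFun {2} {n ℕ.* m} x (combine i j))
          ≡⟨ cong signOf (FinP.finToFun-funToFin code (combine i j)) ⟩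
        signOf (code (combine i j))
          ≡⟨ cong (λ (i , j) → signOf (signIndex (signs i j))) (FinP.remQuot-combine i j) ⟩
        signOf (signIndex (signs i j)) ≡⟨ signOf-signIndex (signs i j) ⟩
        borderDets M i j ∎
        where open ≡-Reasoning
      dets≋ : ∀ i j → borderDets M i j ≋ borderDets (pascalMatrix x) i j [mod 0 ]
      dets≋ i j = ≋-reflexive (trans (sym (signMatrix-x i j)) (sym (borderDets-pascalMatrix x i j)))
      units : ∀ i j → UnitMod 0 (borderDets M i j)
      units i j = Sign⇒UnitMod (signs i j)

open BorderDeterminants
open import Data.Nat using (ℕ; _≤_; _^_; _*_)
open import Data.Integer using (ℤ)
open import Data.List using (List; length; tabulate)
open import Data.List.Properties using (length-tabulate)
open import Data.List.Relation.Unary.All using (All)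
import Data.List.Relation.Unary.All.Properties as All
open import Data.List.Relation.Unary.Any using (Any)
import Data.List.Relation.Unary.Any.Properties as Any
open import Data.List.Relation.Unary.AllPairs using (AllPairs)
import Data.List.Relation.Unary.AllPairs.Properties as AllPairs
open import Data.Product using (Σ; _×_; _,_)
open import Data.Sum using (_⊎_)
open import Function using (_∘_)
open import Relation.Nullary using (¬_)
open import Relation.Binary.PropositionalEquality using (_≡_)

corollary2 : ∀ (n m : ℕ) → 1 ≤ n → 1 ≤ m →
  Σ (List (Matrix ℤ n m)) (λ L →
      length L ≡ 2 ^ (n * m)
    × All (PascalLike ℤ-rawRing) L
    × AllPairs (λ A B → ¬ (A ≗ᴹ B)) L
    × (∀ (M : Matrix ℤ n m) → PascalLike ℤ-rawRing M → Any (λ A → M ≗ᴹ A) L))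
  × (∀ (A B : Matrix ℤ n m) → PascalLike ℤ-rawRing A → PascalLike ℤ-rawRing B →
      ∀ i j → A i j ≡ B i j [mod 2 ])
  × (∀ (q : ℕ) → (q ≡ 3 ⊎ q ≡ 4 ⊎ q ≡ 6) →
      ∀ (M : Matrix ℤ n m) → PascalLike (ℤmod q) M →
      Σ (Matrix ℤ n m) (λ N → PascalLike ℤ-rawRing N × (∀ i j → M i j ≡ N i j [mod q ])))
-- The statement holds for empty matrices as well.
corollary2 n m _ _ =
  ( tabulate (pascalMatrix {n} {m})
  , length-tabulate (pascalMatrix {n} {m})
  , All.tabulate⁺ pascalMatrix-PascalLike
  , AllPairs.tabulate⁺ (λ x≢y → x≢y ∘ pascalMatrix-injective)
  , λ M pascal → let (x , M≗x) = pascalMatrix-surjective M pascal in Any.tabulate⁺ x M≗x )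
  , (λ A B pascalA pascalB i j → ≋⇒≡[mod] (PascalLike-congruent-mod2 A B pascalA pascalB i j))
  , λ q q∈346 M pascal →
      let (N , pascalN , M≋N) = PascalLike-mod-lift q M (unitsMod-3-4-6-areSigns q q∈346) pascal
      in N , pascalN , λ i j → ≋⇒≡[mod] (M≋N i j)
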